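{- Let $G\in\mathcal{G}_n$ with Hermitian adjacency matrix $A$. Then for every positive integer $k$, $e^*A^ke\equiv0\pmod 2$.
   Context: A mixed graph is obtained from a simple undirected graph by orienting a subset of edges; $\mathcal{G}_n$ is the set of mixed graphs on $[n]$. The Hermitian adjacency matrix $A=(a_{u,v})$ has $a_{u,v}=1$ for an undirected edge $uv$, $i$ for a directed edge $u\to v$, $-i$ for a directed edge $v\to u$, $0$ otherwise. $e$ is the all-one vector; congruences are in the Gaussian integers $\mathbb{Z}[i]$. -}

module Defs where

open import Data.Nat using (ℕ; zero; suc)
open import Data.Fin using (Fin; zero; suc)
open import Data.Integer as ℤ using (ℤ; +_)
open import Data.Product using (∃)
open import Relation.Binary.PropositionalEquality using (_≡_)

record ℤ[i] : Set where
  constructor _+_i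
  field
    re : ℤ
    im : ℤ
open ℤ[i] public

infixl 6 _⊕_
infixl 7 _⊗_

0ᵍ 1ᵍ iᵍ -iᵍ 2ᵍ : ℤ[i]
0ᵍ  = (+ 0) + (+ 0) i
1ᵍ  = (+ 1) + (+ 0) i
iᵍ  = (+ 0) + (+ 1) i
-iᵍ = (+ 0) + (ℤ.- (+ 1)) i
2ᵍ  = (+ 2) + (+ 0) i

_⊕_ : ℤ[i] → ℤ[i] → ℤ[i]
(a + b i) ⊕ (c + d i) = (a ℤ.+ c) + (b ℤ.+ d) i

_⊗_ : ℤ[i] → ℤ[i] → ℤ[i]
(a + b i) ⊗ (c + d i) = (a ℤ.* c ℤ.- b ℤ.* d) + (a ℤ.* d ℤ.+ b ℤ.* c) i

conj : ℤ[i] → ℤ[i]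
conj (a + b i) = a + (ℤ.- b) i

_∣ᵍ_ : ℤ[i] → ℤ[i] → Set
m ∣ᵍ z = ∃ λ w → z ≡ m ⊗ w

≡0mod2 : ℤ[i] → Set
≡0mod2 z = 2ᵍ ∣ᵍ z

-- The state of the ordered pair (u , v):
--   none : no edge;  undir : undirected edge uv;
--   out  : directed edge u → v;  inn : directed edge v → u.
data EdgeState : Set where
  none undir out inn : EdgeState

reverse : EdgeState → EdgeState
reverse none  = none
reverse undir = undir
reverse out   = inn
reverse inn   = out

-- A mixed graph: a simple graph (loopless, at most one edge per pair)
-- with a subset of its edges oriented.  Consistency: the state of (v,u)
-- is the reverse of that of (u,v).
record MixedGraph (n : ℕ) : Set where
  field
    edge      : Fin n → Fin n → EdgeState
    loopless  : ∀ u → edge u u ≡ none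
    symmetric : ∀ u v → edge v u ≡ reverse (edge u v)
open MixedGraph public

Matrix : ℕ → Set
Matrix n = Fin n → Fin n → ℤ[i]

entry : EdgeState → ℤ[i]
entry none  = 0ᵍ
entry undir = 1ᵍ
entry out   = iᵍ
entry inn   = -iᵍ

hermAdj : ∀ {n} → MixedGraph n → Matrix n
hermAdj G u v = entry (edge G u v)

sumFin : ∀ {n} → (Fin n → ℤ[i]) → ℤ[i]
sumFin {zero}  f = 0ᵍ
sumFin {suc n} f = f zero ⊕ sumFin (λ j → f (suc j))

_·_ : ∀ {n} → Matrix n → Matrix n → Matrix n
(M · N) u v = sumFin (λ w → M u w ⊗ N w v)

identity : ∀ {n} → Matrix n
identity zero    zero    = 1ᵍ
identity zero    (suc _) = 0ᵍ
identity (suc _) zero    = 0ᵍ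
identity (suc u) (suc v) = identity u v

_^ᴹ_ : ∀ {n} → Matrix n → ℕ → Matrix n
M ^ᴹ zero  = identity
M ^ᴹ suc k = M · (M ^ᴹ k)

e : ∀ {n} → Fin n → ℤ[i]
e _ = 1ᵍ

quadForm : ∀ {n} → (Fin n → ℤ[i]) → Matrix n → (Fin n → ℤ[i]) → ℤ[i]
quadForm x M y = sumFin (λ u → sumFin (λ v → conj (x u) ⊗ M u v ⊗ y v))

-- Reduce modulo 2.  The ring ℤ[i]/(2) = 𝔽₂[i] has characteristic 2 and
-- identifies i with -i, so the Hermitian adjacency matrix becomes a
-- symmetric matrix S with zero diagonal, and it suffices to show that
-- T k = eᵀ Sᵏ e vanishes for k ≥ 1.  Symmetry gives T (a + b) = (Sᵃ e)·(Sᵇ e).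
-- For k = 2m + 1 this is the quadratic form xᵀ S x at x = Sᵐ e, which is 0
-- because its off-diagonal terms cancel in pairs; for k = 2m it is
-- Σᵤ xᵤ² = (Σᵤ xᵤ)² = (T m)², which is 0 by strong induction.

module Submission where

open import Defs
open import Algebra.Bundles using (CommutativeSemiring)
open import Algebra.Structures.Biased using (isCommutativeMonoidˡ; isCommutativeSemiringˡ)
open import Data.Bool using (Bool; true; false; _∧_; _xor_)
open import Data.Bool.Properties using (xor-assoc; xor-comm; xor-same; xor-identityʳ)
open import Data.Bool.Solver using (module xor-∧-Solver)
open import Data.Fin using (Fin; zero; suc)
open import Data.Integer.Divisibility.Signed
  using (_∣_; divides; ∣m∣n⇒∣m+n; ∣m⇒∣m*n; ∣n⇒∣m*n)
open import Data.Integer.Tactic.RingSolver using (solve-∀)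
open import Data.Nat as ℕ using (ℕ; zero; suc; s≤s)
open import Data.Nat.Induction using (<-rec)
open import Data.Nat.Properties using (+-suc; m≤m+n)
open import Data.Product using (_×_; _,_; proj₁; proj₂; ∃-syntax)
open import Data.Sum using (_⊎_; inj₁; inj₂)
open import Data.Vec.Functional using (Vector)
open import Function using (_∘_; case_of_)
open import Level using (0ℓ; _⊔_)
open import Relation.Binary.PropositionalEquality as ≡ using (_≡_)
open import Relation.Binary.PropositionalEquality.Algebra using (isMagma)

even⊎odd : ∀ k → (∃[ m ] k ≡ m ℕ.+ m) ⊎ (∃[ m ] k ≡ suc (m ℕ.+ m))
even⊎odd zero = inj₁ (0 , ≡.refl)
even⊎odd (suc k) with even⊎odd k
... | inj₁ (m , ≡.refl) = inj₂ (m , ≡.refl)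
... | inj₂ (m , ≡.refl) = inj₁ (suc m , ≡.cong suc (≡.sym (+-suc m m)))

module Matrices {c ℓ} (R : CommutativeSemiring c ℓ) where

  open CommutativeSemiring R hiding (zero)
  open import Algebra.Properties.Semiring.Sum semiring
  open import Algebra.Solver.Ring.NaturalCoefficients.Default R
  open import Data.Vec.Functional.Relation.Binary.Equality.Setoid setoid using (_≋_)
  open import Relation.Binary.Reasoning.Setoid setoid

  SquareMatrix : ℕ → Set c
  SquareMatrix n = Fin n → Fin n → Carrier

  Symmetric : ∀ {n} → SquareMatrix n → Set ℓ
  Symmetric M = ∀ u v → M u v ≈ M v u

  Hollow : ∀ {n} → SquareMatrix n → Set ℓ
  Hollow M = ∀ u → M u u ≈ 0#

  infixl 7 _*ᴹ_ _·ᵛ_ _∙_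
  infixr 8 _^_

  _*ᴹ_ : ∀ {n} → SquareMatrix n → SquareMatrix n → SquareMatrix n
  (M *ᴹ N) u v = ∑[ w < _ ] (M u w * N w v)

  1ᴹ : ∀ {n} → SquareMatrix n
  1ᴹ zero    zero    = 1#
  1ᴹ zero    (suc _) = 0#
  1ᴹ (suc _) zero    = 0#
  1ᴹ (suc u) (suc v) = 1ᴹ u v

  _^_ : ∀ {n} → SquareMatrix n → ℕ → SquareMatrix n
  M ^ zero  = 1ᴹ
  M ^ suc k = M *ᴹ M ^ k

  1ᵛ : ∀ {n} → Vector Carrier n
  1ᵛ _ = 1#

  _·ᵛ_ : ∀ {n} → SquareMatrix n → Vector Carrier n → Vector Carrier n
  (M ·ᵛ x) u = ∑[ v < _ ] (M u v * x v)

  _∙_ : ∀ {n} → Vector Carrier n → Vector Carrier n → Carrier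
  x ∙ y = ∑[ u < _ ] (x u * y u)

  ⟨_∣_∣_⟩ : ∀ {n} → Vector Carrier n → SquareMatrix n → Vector Carrier n → Carrier
  ⟨ x ∣ M ∣ y ⟩ = ∑[ u < _ ] ∑[ v < _ ] (x u * M u v * y v)

  ∙-cong : ∀ {n} {x x′ y y′ : Vector Carrier n} → x ≋ x′ → y ≋ y′ → x ∙ y ≈ x′ ∙ y′
  ∙-cong x≋x′ y≋y′ = sum-cong-≋ (λ u → *-cong (x≋x′ u) (y≋y′ u))

  sum-zeroˡ : ∀ {n} (x : Vector Carrier n) → ∑[ u < n ] (0# * x u) ≈ 0#
  sum-zeroˡ {n} x = trans (sum-cong-≋ (λ u → zeroˡ (x u))) (sum-replicate-zero n)

  1ᴹ-·ᵛ : ∀ {n} (x : Vector Carrier n) → 1ᴹ ·ᵛ x ≋ x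
  1ᴹ-·ᵛ x zero    = trans (+-cong (*-identityˡ (x zero)) (sum-zeroˡ (x ∘ suc))) (+-identityʳ (x zero))
  1ᴹ-·ᵛ x (suc u) = trans (+-cong (zeroˡ (x zero)) (1ᴹ-·ᵛ (x ∘ suc) u)) (+-identityˡ (x (suc u)))

  *ᴹ-·ᵛ : ∀ {n} (M N : SquareMatrix n) x → (M *ᴹ N) ·ᵛ x ≋ M ·ᵛ (N ·ᵛ x)
  *ᴹ-·ᵛ {n} M N x u = begin
    ∑[ v < n ] (∑[ w < n ] (M u w * N w v) * x v)
      ≈⟨ sum-cong-≋ (λ v → *-distribʳ-sum (x v) (λ w → M u w * N w v)) ⟩
    ∑[ v < n ] ∑[ w < n ] (M u w * N w v * x v)
      ≈⟨ ∑-comm (λ v w → M u w * N w v * x v) ⟩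
    ∑[ w < n ] ∑[ v < n ] (M u w * N w v * x v)
      ≈⟨ sum-cong-≋ (λ w → sum-cong-≋ (λ v → *-assoc (M u w) (N w v) (x v))) ⟩
    ∑[ w < n ] ∑[ v < n ] (M u w * (N w v * x v))
      ≈⟨ sum-cong-≋ (λ w → sym (*-distribˡ-sum (M u w) (λ v → N w v * x v))) ⟩
    ∑[ w < n ] (M u w * ∑[ v < n ] (N w v * x v))
      ∎

  ∙-·ᵛ : ∀ {n} x (M : SquareMatrix n) y → x ∙ (M ·ᵛ y) ≈ ⟨ x ∣ M ∣ y ⟩
  ∙-·ᵛ {n} x M y = begin
    ∑[ u < n ] (x u * ∑[ v < n ] (M u v * y v))
      ≈⟨ sum-cong-≋ (λ u → *-distribˡ-sum (x u) (λ v → M u v * y v)) ⟩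
    ∑[ u < n ] ∑[ v < n ] (x u * (M u v * y v))
      ≈⟨ sum-cong-≋ (λ u → sum-cong-≋ (λ v → sym (*-assoc (x u) (M u v) (y v)))) ⟩
    ⟨ x ∣ M ∣ y ⟩
      ∎

  ·ᵛ-∙-symmetric : ∀ {n} {M : SquareMatrix n} → Symmetric M →
                   ∀ x y → (M ·ᵛ x) ∙ y ≈ x ∙ (M ·ᵛ y)
  ·ᵛ-∙-symmetric {n} {M} M-sym x y = begin
    ∑[ u < n ] (∑[ v < n ] (M u v * x v) * y u)
      ≈⟨ sum-cong-≋ (λ u → *-distribʳ-sum (y u) (λ v → M u v * x v)) ⟩
    ∑[ u < n ] ∑[ v < n ] (M u v * x v * y u)
      ≈⟨ ∑-comm (λ u v → M u v * x v * y u) ⟩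
    ∑[ v < n ] ∑[ u < n ] (M u v * x v * y u)
      ≈⟨ sum-cong-≋ (λ v → sum-cong-≋ (λ u → rearrange (M-sym u v))) ⟩
    ∑[ v < n ] ∑[ u < n ] (x v * (M v u * y u))
      ≈⟨ sum-cong-≋ (λ v → sym (*-distribˡ-sum (x v) (λ u → M v u * y u))) ⟩
    ∑[ v < n ] (x v * ∑[ u < n ] (M v u * y u))
      ∎
    where
    rearrange : ∀ {a b c d} → a ≈ b → a * c * d ≈ c * (b * d)
    rearrange {a} {b} {c} {d} a≈b = trans (*-congʳ (*-congʳ a≈b))
      (solve 3 (λ b c d → b :* c :* d := c :* (b :* d)) refl b c d)

  rowSums : ∀ {n} → SquareMatrix n → Vector Carrier n
  rowSums M = M ·ᵛ 1ᵛ

  sumOfEntries : ∀ {n} → SquareMatrix n → Carrier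
  sumOfEntries M = ⟨ 1ᵛ ∣ M ∣ 1ᵛ ⟩

  sum-rowSums : ∀ {n} (M : SquareMatrix n) → sum (rowSums M) ≈ sumOfEntries M
  sum-rowSums M = trans (sum-cong-≋ (λ u → sym (*-identityˡ (rowSums M u)))) (∙-·ᵛ 1ᵛ M 1ᵛ)

  rowSums-^-∙ : ∀ {n} {M : SquareMatrix n} → Symmetric M →
                ∀ a b → rowSums (M ^ a) ∙ rowSums (M ^ b) ≈ sumOfEntries (M ^ (a ℕ.+ b))
  rowSums-^-∙ {n} {M} M-sym zero b = begin
    rowSums 1ᴹ ∙ rowSums (M ^ b)  ≈⟨ ∙-cong (1ᴹ-·ᵛ {n} 1ᵛ) (λ _ → refl) ⟩
    1ᵛ ∙ rowSums (M ^ b)          ≈⟨ ∙-·ᵛ 1ᵛ (M ^ b) 1ᵛ ⟩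
    sumOfEntries (M ^ b)          ∎
  rowSums-^-∙ {n} {M} M-sym (suc a) b = begin
    rowSums (M ^ suc a) ∙ rowSums (M ^ b)
      ≈⟨ ∙-cong (*ᴹ-·ᵛ M (M ^ a) 1ᵛ) (λ _ → refl) ⟩
    (M ·ᵛ rowSums (M ^ a)) ∙ rowSums (M ^ b)
      ≈⟨ ·ᵛ-∙-symmetric M-sym _ _ ⟩
    rowSums (M ^ a) ∙ (M ·ᵛ rowSums (M ^ b))
      ≈⟨ ∙-cong (λ _ → refl) (λ u → sym (*ᴹ-·ᵛ M (M ^ b) 1ᵛ u)) ⟩
    rowSums (M ^ a) ∙ rowSums (M ^ suc b)
      ≈⟨ rowSums-^-∙ M-sym a (suc b) ⟩
    sumOfEntries (M ^ (a ℕ.+ suc b))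
      ≡⟨ ≡.cong (λ k → sumOfEntries (M ^ k)) (+-suc a b) ⟩
    sumOfEntries (M ^ suc (a ℕ.+ b))
      ∎

HasCharacteristicTwo : ∀ {c ℓ} → CommutativeSemiring c ℓ → Set (c ⊔ ℓ)
HasCharacteristicTwo R = ∀ x → x + x ≈ 0#
  where open CommutativeSemiring R

module CharacteristicTwo {c ℓ} (R : CommutativeSemiring c ℓ) (x+x≈0 : HasCharacteristicTwo R) where

  open CommutativeSemiring R hiding (zero)
  open import Algebra.Properties.Semiring.Sum semiring
  open import Algebra.Solver.Ring.NaturalCoefficients.Default R
  open import Relation.Binary.Reasoning.Setoid setoid
  open Matrices R

  square-+ : ∀ a b → (a + b) * (a + b) ≈ a * a + b * b
  square-+ a b = begin
    (a + b) * (a + b)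
      ≈⟨ solve 2 (λ a b → (a :+ b) :* (a :+ b) := a :* a :+ b :* b :+ (a :* b :+ a :* b)) refl a b ⟩
    a * a + b * b + (a * b + a * b)  ≈⟨ +-congˡ (x+x≈0 (a * b)) ⟩
    a * a + b * b + 0#               ≈⟨ +-identityʳ _ ⟩
    a * a + b * b                    ∎

  square-sum : ∀ {n} (x : Vector Carrier n) → sum x * sum x ≈ ∑[ u < n ] (x u * x u)
  square-sum {zero}  x = zeroˡ 0#
  square-sum {suc n} x =
    trans (square-+ (x zero) (sum (x ∘ suc))) (+-congˡ (square-sum (x ∘ suc)))

  sum-sum-symmetric-hollow : ∀ {n} (M : SquareMatrix n) → Symmetric M → Hollow M →
                             ∑[ u < n ] ∑[ v < n ] M u v ≈ 0#
  sum-sum-symmetric-hollow {zero}  M M-sym M-hollow = refl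
  sum-sum-symmetric-hollow {suc n} M M-sym M-hollow = begin
    (M zero zero + first) + ∑[ u < n ] (M (suc u) zero + ∑[ v < n ] M (suc u) (suc v))
      ≈⟨ +-congˡ (∑-distrib-+ (λ u → M (suc u) zero) (λ u → ∑[ v < n ] M (suc u) (suc v))) ⟩
    (M zero zero + first) + (∑[ u < n ] M (suc u) zero + ∑[ u < n ] ∑[ v < n ] M (suc u) (suc v))
      ≈⟨ +-cong (+-congʳ (M-hollow zero))
                (+-cong (sum-cong-≋ (λ u → M-sym (suc u) zero))
                        (sum-sum-symmetric-hollow (λ u v → M (suc u) (suc v))
                           (λ u v → M-sym (suc u) (suc v)) (λ u → M-hollow (suc u)))) ⟩
    (0# + first) + (first + 0#)
      ≈⟨ +-cong (+-identityˡ first) (+-identityʳ first) ⟩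
    first + first
      ≈⟨ x+x≈0 first ⟩
    0# ∎
    where
    first : Carrier
    first = ∑[ v < n ] M zero (suc v)

  quadraticForm-symmetric-hollow : ∀ {n} {M : SquareMatrix n} → Symmetric M → Hollow M →
                                   ∀ x → ⟨ x ∣ M ∣ x ⟩ ≈ 0#
  quadraticForm-symmetric-hollow {M = M} M-sym M-hollow x =
    sum-sum-symmetric-hollow (λ u v → x u * M u v * x v)
      (λ u v → trans (*-congʳ (*-congˡ (M-sym u v)))
                     (solve 3 (λ a m b → a :* m :* b := b :* m :* a) refl (x u) (M v u) (x v)))
      (λ u → trans (*-congʳ (trans (*-congˡ (M-hollow u)) (zeroʳ (x u)))) (zeroˡ (x u)))

  module _ {n} {M : SquareMatrix n} (M-sym : Symmetric M) where

    sumOfEntries-^-double : ∀ m → sumOfEntries (M ^ (m ℕ.+ m)) ≈ sumOfEntries (M ^ m) * sumOfEntries (M ^ m)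
    sumOfEntries-^-double m = begin
      sumOfEntries (M ^ (m ℕ.+ m))
        ≈⟨ sym (rowSums-^-∙ M-sym m m) ⟩
      rowSums (M ^ m) ∙ rowSums (M ^ m)
        ≈⟨ sym (square-sum (rowSums (M ^ m))) ⟩
      sum (rowSums (M ^ m)) * sum (rowSums (M ^ m))
        ≈⟨ *-cong (sum-rowSums (M ^ m)) (sum-rowSums (M ^ m)) ⟩
      sumOfEntries (M ^ m) * sumOfEntries (M ^ m)
        ∎

    module _ (M-hollow : Hollow M) where

      sumOfEntries-^-odd : ∀ m → sumOfEntries (M ^ suc (m ℕ.+ m)) ≈ 0#
      sumOfEntries-^-odd m = begin
        sumOfEntries (M ^ suc (m ℕ.+ m))
          ≡⟨ ≡.cong (λ k → sumOfEntries (M ^ k)) (≡.sym (+-suc m m)) ⟩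
        sumOfEntries (M ^ (m ℕ.+ suc m))
          ≈⟨ sym (rowSums-^-∙ M-sym m (suc m)) ⟩
        rowSums (M ^ m) ∙ rowSums (M ^ suc m)
          ≈⟨ ∙-cong (λ _ → refl) (*ᴹ-·ᵛ M (M ^ m) 1ᵛ) ⟩
        rowSums (M ^ m) ∙ (M ·ᵛ rowSums (M ^ m))
          ≈⟨ ∙-·ᵛ (rowSums (M ^ m)) M (rowSums (M ^ m)) ⟩
        ⟨ rowSums (M ^ m) ∣ M ∣ rowSums (M ^ m) ⟩
          ≈⟨ quadraticForm-symmetric-hollow M-sym M-hollow (rowSums (M ^ m)) ⟩
        0#
          ∎

      sumOfEntries-^-suc≈0 : ∀ k → sumOfEntries (M ^ suc k) ≈ 0#
      sumOfEntries-^-suc≈0 = <-rec _ λ k rec → case even⊎odd k of λ where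
        (inj₁ (m , ≡.refl)) → sumOfEntries-^-odd m
        (inj₂ (m , ≡.refl)) → begin
          sumOfEntries (M ^ suc (suc (m ℕ.+ m)))
            ≡⟨ ≡.cong (λ k → sumOfEntries (M ^ suc k)) (≡.sym (+-suc m m)) ⟩
          sumOfEntries (M ^ (suc m ℕ.+ suc m))
            ≈⟨ sumOfEntries-^-double (suc m) ⟩
          sumOfEntries (M ^ suc m) * sumOfEntries (M ^ suc m)
            ≈⟨ *-congʳ (rec (s≤s (m≤m+n m m))) ⟩
          0# * sumOfEntries (M ^ suc m)
            ≈⟨ zeroˡ _ ⟩
          0#
            ∎

open import Data.Integer using (ℤ; +_; _+_; _*_; -_; _-_)
open import Data.Integer.Properties using (+-inverseʳ; +-identityʳ)
open ≡ using (refl; sym; trans; cong; cong₂; subst)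

ℤ₂[i] : Set
ℤ₂[i] = Bool × Bool

infixl 6 _+₂_
infixl 7 _*₂_

_+₂_ : ℤ₂[i] → ℤ₂[i] → ℤ₂[i]
(a , b) +₂ (c , d) = (a xor c , b xor d)

_*₂_ : ℤ₂[i] → ℤ₂[i] → ℤ₂[i]
(a , b) *₂ (c , d) = ((a ∧ c) xor (b ∧ d) , (a ∧ d) xor (b ∧ c))

0₂ 1₂ i₂ : ℤ₂[i]
0₂ = (false , false)
1₂ = (true , false)
i₂ = (false , true)

+₂-assoc : ∀ x y z → (x +₂ y) +₂ z ≡ x +₂ (y +₂ z)
+₂-assoc (a , b) (c , d) (e , f) = cong₂ _,_ (xor-assoc a c e) (xor-assoc b d f)

+₂-comm : ∀ x y → x +₂ y ≡ y +₂ x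
+₂-comm (a , b) (c , d) = cong₂ _,_ (xor-comm a c) (xor-comm b d)

x+₂x≡0₂ : ∀ x → x +₂ x ≡ 0₂
x+₂x≡0₂ (a , b) = cong₂ _,_ (xor-same a) (xor-same b)

module _ where
  open xor-∧-Solver

  *₂-assoc : ∀ x y z → (x *₂ y) *₂ z ≡ x *₂ (y *₂ z)
  *₂-assoc (a , b) (c , d) (e , f) = cong₂ _,_
    (solve 6 (λ a b c d e f → (a :* c :+ b :* d) :* e :+ (a :* d :+ b :* c) :* f
                           := a :* (c :* e :+ d :* f) :+ b :* (c :* f :+ d :* e)) refl a b c d e f)
    (solve 6 (λ a b c d e f → (a :* c :+ b :* d) :* f :+ (a :* d :+ b :* c) :* e
                           := a :* (c :* f :+ d :* e) :+ b :* (c :* e :+ d :* f)) refl a b c d e f)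

  *₂-comm : ∀ x y → x *₂ y ≡ y *₂ x
  *₂-comm (a , b) (c , d) = cong₂ _,_
    (solve 4 (λ a b c d → a :* c :+ b :* d := c :* a :+ d :* b) refl a b c d)
    (solve 4 (λ a b c d → a :* d :+ b :* c := c :* b :+ d :* a) refl a b c d)

  *₂-distribʳ-+₂ : ∀ z x y → (x +₂ y) *₂ z ≡ x *₂ z +₂ y *₂ z
  *₂-distribʳ-+₂ (e , f) (a , b) (c , d) = cong₂ _,_
    (solve 6 (λ a b c d e f → (a :+ c) :* e :+ (b :+ d) :* f
                           := (a :* e :+ b :* f) :+ (c :* e :+ d :* f)) refl a b c d e f)
    (solve 6 (λ a b c d e f → (a :+ c) :* f :+ (b :+ d) :* e
                           := (a :* f :+ b :* e) :+ (c :* f :+ d :* e)) refl a b c d e f)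

*₂-identityˡ : ∀ x → 1₂ *₂ x ≡ x
*₂-identityˡ (a , b) = cong₂ _,_ (xor-identityʳ a) (xor-identityʳ b)

ℤ₂[i]-commutativeSemiring : CommutativeSemiring 0ℓ 0ℓ
ℤ₂[i]-commutativeSemiring = record
  { _≈_ = _≡_
  ; _+_ = _+₂_
  ; _*_ = _*₂_
  ; 0#  = 0₂
  ; 1#  = 1₂
  ; isCommutativeSemiring = isCommutativeSemiringˡ record
    { +-isCommutativeMonoid = isCommutativeMonoidˡ record
      { isSemigroup = record { isMagma = isMagma _+₂_ ; assoc = +₂-assoc }
      ; identityˡ   = λ _ → refl
      ; comm        = +₂-comm
      }
    ; *-isCommutativeMonoid = isCommutativeMonoidˡ record
      { isSemigroup = record { isMagma = isMagma _*₂_ ; assoc = *₂-assoc }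
      ; identityˡ   = *₂-identityˡ
      ; comm        = *₂-comm
      }
    ; distribʳ = *₂-distribʳ-+₂
    ; zeroˡ    = λ _ → refl
    }
  }

infix 4 _≡₂_

-- This relation and _reducesTo_ are records rather than definitions so that
-- their indices can be recovered from a proof by unification.
record _≡₂_ (x y : ℤ) : Set where
  constructor 2∣diff
  field 2∣x-y : + 2 ∣ x - y

≡₂-refl : ∀ x → x ≡₂ x
≡₂-refl x = 2∣diff (divides (+ 0) (+-inverseʳ x))

≡₂-trans : ∀ {x y z} → x ≡₂ y → y ≡₂ z → x ≡₂ z
≡₂-trans {x} {y} {z} (2∣diff p) (2∣diff q) =
  2∣diff (subst (+ 2 ∣_) (telescope x y z) (∣m∣n⇒∣m+n p q))
  where
  telescope : ∀ x y z → (x - y) + (y - z) ≡ x - z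
  telescope = solve-∀

+-pres-≡₂ : ∀ {x x′ y y′} → x ≡₂ x′ → y ≡₂ y′ → x + y ≡₂ x′ + y′
+-pres-≡₂ {x} {x′} {y} {y′} (2∣diff p) (2∣diff q) =
  2∣diff (subst (+ 2 ∣_) (rearrange x x′ y y′) (∣m∣n⇒∣m+n p q))
  where
  rearrange : ∀ x x′ y y′ → (x - x′) + (y - y′) ≡ (x + y) - (x′ + y′)
  rearrange = solve-∀

*-pres-≡₂ : ∀ {x x′ y y′} → x ≡₂ x′ → y ≡₂ y′ → x * y ≡₂ x′ * y′
*-pres-≡₂ {x} {x′} {y} {y′} (2∣diff p) (2∣diff q) =
  2∣diff (subst (+ 2 ∣_) (rearrange x x′ y y′) (∣m∣n⇒∣m+n (∣m⇒∣m*n y p) (∣n⇒∣m*n x′ q)))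
  where
  rearrange : ∀ x x′ y y′ → (x - x′) * y + x′ * (y - y′) ≡ x * y - x′ * y′
  rearrange = solve-∀

-x≡₂x : ∀ x → - x ≡₂ x
-x≡₂x x = 2∣diff (divides (- x) (-x-x≡-x*2 x))
  where
  -x-x≡-x*2 : ∀ x → - x - x ≡ - x * + 2
  -x-x≡-x*2 = solve-∀

⟦_⟧ : Bool → ℤ
⟦ false ⟧ = + 0
⟦ true  ⟧ = + 1

⟦⟧-xor : ∀ a b → ⟦ a ⟧ + ⟦ b ⟧ ≡₂ ⟦ a xor b ⟧
⟦⟧-xor false false = ≡₂-refl (+ 0)
⟦⟧-xor false true  = ≡₂-refl (+ 1)
⟦⟧-xor true  false = ≡₂-refl (+ 1)
⟦⟧-xor true  true  = 2∣diff (divides (+ 1) refl)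

⟦⟧-∧ : ∀ a b → ⟦ a ⟧ * ⟦ b ⟧ ≡ ⟦ a ∧ b ⟧
⟦⟧-∧ false b     = refl
⟦⟧-∧ true  false = refl
⟦⟧-∧ true  true  = refl

infix 4 _reducesTo_

record _reducesTo_ (z : ℤ[i]) (x : ℤ₂[i]) : Set where
  constructor _,_
  field
    re-reduces : re z ≡₂ ⟦ proj₁ x ⟧
    im-reduces : im z ≡₂ ⟦ proj₂ x ⟧

⟦⟧-+-pres : ∀ {x y a b} → x ≡₂ ⟦ a ⟧ → y ≡₂ ⟦ b ⟧ → x + y ≡₂ ⟦ a xor b ⟧
⟦⟧-+-pres {a = a} {b} p q = ≡₂-trans (+-pres-≡₂ p q) (⟦⟧-xor a b)

⟦⟧-*-pres : ∀ {x y a b} → x ≡₂ ⟦ a ⟧ → y ≡₂ ⟦ b ⟧ → x * y ≡₂ ⟦ a ∧ b ⟧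
⟦⟧-*-pres {a = a} {b} p q = subst (_ ≡₂_) (⟦⟧-∧ a b) (*-pres-≡₂ p q)

reducesTo-⊕ : ∀ {z w x y} → z reducesTo x → w reducesTo y → z ⊕ w reducesTo x +₂ y
reducesTo-⊕ {x = _ , _} {_ , _} (p , q) (p′ , q′) = ⟦⟧-+-pres p p′ , ⟦⟧-+-pres q q′

reducesTo-⊗ : ∀ {z w x y} → z reducesTo x → w reducesTo y → z ⊗ w reducesTo x *₂ y
reducesTo-⊗ {x = _ , _} {_ , _} (p , q) (p′ , q′) =
  ⟦⟧-+-pres (⟦⟧-*-pres p p′) (≡₂-trans (-x≡₂x _) (⟦⟧-*-pres q q′)) ,
  ⟦⟧-+-pres (⟦⟧-*-pres p q′) (⟦⟧-*-pres q p′)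

reducesTo-conj : ∀ {z x} → z reducesTo x → conj z reducesTo x
reducesTo-conj {x = _ , _} (p , q) = p , ≡₂-trans (-x≡₂x _) q

reducesTo-0₂ : ∀ {z} → z reducesTo 0₂ → ≡0mod2 z
reducesTo-0₂ {a + b i} (2∣diff (divides q₁ a-0≡q₁*2) ,
                        2∣diff (divides q₂ b-0≡q₂*2)) =
  q₁ + q₂ i ,
  cong₂ _+_i (trans (sym (+-identityʳ a)) (trans a-0≡q₁*2 (re-2⊗ q₁ q₂)))
             (trans (sym (+-identityʳ b)) (trans b-0≡q₂*2 (im-2⊗ q₁ q₂)))
  where
  re-2⊗ : ∀ q₁ q₂ → q₁ * + 2 ≡ + 2 * q₁ - + 0 * q₂
  re-2⊗ = solve-∀
  im-2⊗ : ∀ q₁ q₂ → q₂ * + 2 ≡ + 2 * q₂ + + 0 * q₁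
  im-2⊗ = solve-∀

open Matrices ℤ₂[i]-commutativeSemiring
open CharacteristicTwo ℤ₂[i]-commutativeSemiring x+₂x≡0₂
open import Algebra.Properties.Semiring.Sum (CommutativeSemiring.semiring ℤ₂[i]-commutativeSemiring) using (sum)

reducesTo-sumFin : ∀ {n} {f : Fin n → ℤ[i]} {g : Fin n → ℤ₂[i]} →
                   (∀ u → f u reducesTo g u) → sumFin f reducesTo sum g
reducesTo-sumFin {zero}  f↦g = ≡₂-refl (+ 0) , ≡₂-refl (+ 0)
reducesTo-sumFin {suc n} f↦g = reducesTo-⊕ (f↦g zero) (reducesTo-sumFin (λ u → f↦g (suc u)))

MatrixReducesTo : ∀ {n} → Matrix n → SquareMatrix n → Set
MatrixReducesTo M N = ∀ u v → M u v reducesTo N u v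

reducesTo-identity : ∀ {n} → MatrixReducesTo (identity {n}) 1ᴹ
reducesTo-identity zero    zero    = ≡₂-refl (+ 1) , ≡₂-refl (+ 0)
reducesTo-identity zero    (suc v) = ≡₂-refl (+ 0) , ≡₂-refl (+ 0)
reducesTo-identity (suc u) zero    = ≡₂-refl (+ 0) , ≡₂-refl (+ 0)
reducesTo-identity (suc u) (suc v) = reducesTo-identity u v

reducesTo-^ᴹ : ∀ {n} {M : Matrix n} {N} → MatrixReducesTo M N →
               ∀ k → MatrixReducesTo (M ^ᴹ k) (N ^ k)
reducesTo-^ᴹ M↦N zero        = reducesTo-identity
reducesTo-^ᴹ M↦N (suc k) u v =
  reducesTo-sumFin (λ w → reducesTo-⊗ (M↦N u w) (reducesTo-^ᴹ M↦N k w v))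

reducesTo-quadForm : ∀ {n} {x y : Fin n → ℤ[i]} {M} {x′ y′ M′} →
  (∀ u → x u reducesTo x′ u) → MatrixReducesTo M M′ → (∀ u → y u reducesTo y′ u) →
  quadForm x M y reducesTo ⟨ x′ ∣ M′ ∣ y′ ⟩
reducesTo-quadForm x↦x′ M↦M′ y↦y′ = reducesTo-sumFin λ u → reducesTo-sumFin λ v →
  reducesTo-⊗ (reducesTo-⊗ (reducesTo-conj (x↦x′ u)) (M↦M′ u v)) (y↦y′ v)

entry₂ : EdgeState → ℤ₂[i]
entry₂ none  = 0₂
entry₂ undir = 1₂
entry₂ out   = i₂
entry₂ inn   = i₂

reducesTo-entry : ∀ s → entry s reducesTo entry₂ s
reducesTo-entry none  = ≡₂-refl (+ 0) , ≡₂-refl (+ 0)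
reducesTo-entry undir = ≡₂-refl (+ 1) , ≡₂-refl (+ 0)
reducesTo-entry out   = ≡₂-refl (+ 0) , ≡₂-refl (+ 1)
reducesTo-entry inn   = ≡₂-refl (+ 0) , -x≡₂x (+ 1)

entry₂-reverse : ∀ s → entry₂ (reverse s) ≡ entry₂ s
entry₂-reverse none  = refl
entry₂-reverse undir = refl
entry₂-reverse out   = refl
entry₂-reverse inn   = refl

hermAdj₂ : ∀ {n} → MixedGraph n → SquareMatrix n
hermAdj₂ G u v = entry₂ (edge G u v)

hermAdj₂-symmetric : ∀ {n} (G : MixedGraph n) → Symmetric (hermAdj₂ G)
hermAdj₂-symmetric G u v = trans (cong entry₂ (symmetric G v u)) (entry₂-reverse (edge G v u))

hermAdj₂-hollow : ∀ {n} (G : MixedGraph n) → Hollow (hermAdj₂ G)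
hermAdj₂-hollow G u = cong entry₂ (loopless G u)

lemma13 : ∀ n (G : MixedGraph n) (k : ℕ) →
    ≡0mod2 (quadForm e (hermAdj G ^ᴹ suc k) e)
lemma13 n G k = reducesTo-0₂ (subst (quadForm e (hermAdj G ^ᴹ suc k) e reducesTo_) vanishes reduction)
  where
  S : SquareMatrix n
  S = hermAdj₂ G

  A↦S : MatrixReducesTo (hermAdj G) S
  A↦S u v = reducesTo-entry (edge G u v)

  e↦1ᵛ : ∀ u → e u reducesTo 1ᵛ u
  e↦1ᵛ _ = ≡₂-refl (+ 1) , ≡₂-refl (+ 0)

  reduction : quadForm e (hermAdj G ^ᴹ suc k) e reducesTo sumOfEntries (S ^ suc k)
  reduction = reducesTo-quadForm e↦1ᵛ (reducesTo-^ᴹ A↦S (suc k)) e↦1ᵛ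

  vanishes : sumOfEntries (S ^ suc k) ≡ 0₂
  vanishes = sumOfEntries-^-suc≈0 (hermAdj₂-symmetric G) (hermAdj₂-hollow G) k
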